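{- Let $\mathcal{S}=[0,C_1]\times\cdots\times[0,C_d]\subset\mathbb{Z}^d$ with the componentwise order, and let $a$ be an ASHE with direction vector $v$ and empty blocking relation $\mathcal{R}=\emptyset$. Then for any $m,M\in\mathcal{S}$ with $m\le M$, writing $[m',M']=[m,M]\boxdot a$, we have $\|M'-m'\|_1\le\|M-m\|_1$.
   Context: For $x\in\mathcal{S}$: $CR(x)=\{i: x_i+v_i\notin[0,C_i]\}$ and $B(x)=\{i:\exists j\in CR(x),\ (j,i)\in\mathcal{R}\}$. An event $a$ is an ASHE with direction vector $v\in\mathbb{Z}^d$ and blocking relation $\mathcal{R}$ (a binary relation on $\{1,\dots,d\}$) if for all $x\in\mathcal{S}$ and all $i$: $(x\cdot a)_i=x_i$ if $i\in B(x)$ and $(x\cdot a)_i=\min(\max(x_i+v_i,0),C_i)$ otherwise. $[m,M]=\{x\in\mathcal{S}: m\le x\le M\}$, and $[m,M]\boxdot a=[\inf_{x\in[m,M]}x\cdot a,\ \sup_{x\in[m,M]}x\cdot a]$ (componentwise inf/sup). $\|y\|_1=\sum_i|y_i|$. -}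

module Defs where

open import Data.Nat using (ℕ; zero; suc)
import Data.Nat as ℕ
open import Data.Integer using (ℤ; +_; _+_; _-_; _≤_; _⊓_; _⊔_; ∣_∣)
open import Data.Fin using (Fin; zero; suc)
open import Data.Product using (Σ; _×_; ∃-syntax)
open import Relation.Nullary using (¬_)
open import Relation.Binary.PropositionalEquality using (_≡_)

Pt : ℕ → Set
Pt d = Fin d → ℤ

_≤ᵥ_ : ∀ {d} → Pt d → Pt d → Set
x ≤ᵥ y = ∀ i → x i ≤ y i

InS : ∀ {d} → (C : Fin d → ℕ) → Pt d → Set
InS C x = ∀ i → (+ 0 ≤ x i) × (x i ≤ + C i)

InBox : ∀ {d} → (C : Fin d → ℕ) → Pt d → Pt d → Pt d → Set
InBox C m M x = InS C x × (m ≤ᵥ x) × (x ≤ᵥ M)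

clamp : ℤ → ℕ → ℤ
clamp y c = (y ⊔ + 0) ⊓ + c

CR : ∀ {d} → (C : Fin d → ℕ) → (v : Pt d) → Pt d → Fin d → Set
CR C v x i = ¬ ((+ 0 ≤ x i + v i) × (x i + v i ≤ + C i))

Blocked : ∀ {d} → (C : Fin d → ℕ) → (v : Pt d) → (R : Fin d → Fin d → Set) → Pt d → Fin d → Set
Blocked C v R x i = ∃[ j ] (CR C v x j × R j i)

IsASHE : ∀ {d} → (C : Fin d → ℕ) → (a : Pt d → Pt d) → (v : Pt d) → (R : Fin d → Fin d → Set) → Set
IsASHE C a v R = ∀ x → InS C x → ∀ i →
  (Blocked C v R x i → a x i ≡ x i) × (¬ Blocked C v R x i → a x i ≡ clamp (x i + v i) (C i))

EmptyRel : ∀ {d} → (Fin d → Fin d → Set) → Set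
EmptyRel R = ∀ j i → ¬ R j i

IsInfAt : ∀ {d} → (C : Fin d → ℕ) → (a : Pt d → Pt d) → Pt d → Pt d → Fin d → ℤ → Set
IsInfAt C a m M i z =
  (∀ x → InBox C m M x → z ≤ a x i) ×
  (∀ l → (∀ x → InBox C m M x → l ≤ a x i) → l ≤ z)

IsSupAt : ∀ {d} → (C : Fin d → ℕ) → (a : Pt d → Pt d) → Pt d → Pt d → Fin d → ℤ → Set
IsSupAt C a m M i z =
  (∀ x → InBox C m M x → a x i ≤ z) ×
  (∀ u → (∀ x → InBox C m M x → a x i ≤ u) → z ≤ u)

IsBoxImage : ∀ {d} → (C : Fin d → ℕ) → (a : Pt d → Pt d) → (m M m' M' : Pt d) → Set
IsBoxImage C a m M m' M' = ∀ i → IsInfAt C a m M i (m' i) × IsSupAt C a m M i (M' i)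

sumFin : ∀ {d} → (Fin d → ℕ) → ℕ
sumFin {zero} f = 0
sumFin {suc d} f = f zero ℕ.+ sumFin (λ i → f (suc i))

norm1 : ∀ {d} → Pt d → ℕ
norm1 y = sumFin (λ i → ∣ y i ∣)

_-ᵥ_ : ∀ {d} → Pt d → Pt d → Pt d
(x -ᵥ y) i = x i - y i

module Submission where

-- An ASHE with empty blocking relation is never blocked, so on S it acts
-- coordinatewise as  x ↦ clamp (x_i + v_i) (C_i).  The proof rests on two
-- facts about this coordinate map:
--   * it is monotone, so over an interval [m,M] its infimum is attained at m
--     and its supremum at M; hence the image interval [m',M'] has endpoints
--     m'_i = clamp (m_i + v_i) and M'_i = clamp (M_i + v_i);
--   * it is 1-Lipschitz (clamping cannot increase the distance of two
--     numbers), so each side satisfies  |M'_i - m'_i| ≤ |M_i - m_i|.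
-- Summing the coordinatewise inequalities gives ‖M' - m'‖₁ ≤ ‖M - m‖₁.

open import Defs
open import Data.Nat using (ℕ; _≤_)
open import Data.Integer using (ℤ)
open import Data.Fin using (Fin)

import Data.Nat as ℕ
import Data.Nat.Properties as ℕP
open import Data.Integer as ℤ using (+_; _+_; _-_; _⊓_; _⊔_; ∣_∣)
import Data.Integer.Properties as ℤP
open import Data.Fin using (zero; suc)
open import Data.Product using (_×_; _,_; proj₁; proj₂)
open import Relation.Binary.PropositionalEquality
open import Data.Integer.Tactic.RingSolver using (solve-∀)

⊔-shift : ∀ y b k → (y + + k) ⊔ b ℤ.≤ (y ⊔ b) + + k
⊔-shift y b k = ℤP.≤-trans
  (ℤP.⊔-monoʳ-≤ (y + + k) (ℤP.i≤i+j b (+ k)))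
  (ℤP.≤-reflexive (sym (ℤP.mono-≤-distrib-⊔ (ℤP.+-monoˡ-≤ (+ k)) y b)))

⊓-shift : ∀ y b k → (y + + k) ⊓ b ℤ.≤ (y ⊓ b) + + k
⊓-shift y b k = ℤP.≤-trans
  (ℤP.⊓-monoʳ-≤ (y + + k) (ℤP.i≤i+j b (+ k)))
  (ℤP.≤-reflexive (sym (ℤP.mono-≤-distrib-⊓ (ℤP.+-monoˡ-≤ (+ k)) y b)))

clamp-mono : ∀ {y z} c → y ℤ.≤ z → clamp y c ℤ.≤ clamp z c
clamp-mono c y≤z = ℤP.⊓-monoˡ-≤ (+ c) (ℤP.⊔-monoˡ-≤ (+ 0) y≤z)

clamp-shift : ∀ y k c → clamp (y + + k) c ℤ.≤ clamp y c + + k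
clamp-shift y k c = ℤP.≤-trans
  (ℤP.⊓-monoˡ-≤ (+ c) (⊔-shift y (+ 0) k))
  (⊓-shift (y ⊔ + 0) (+ c) k)

dist-le : ∀ {i j} k → i ℤ.≤ j → j ℤ.≤ i + + k → ∣ j - i ∣ ≤ k
dist-le {i} {j} k i≤j j≤i+k = ℤP.drop‿+≤+ (begin
    + ∣ j - i ∣    ≡⟨ ℤP.0≤i⇒+∣i∣≡i (ℤP.i≤j⇒0≤j-i i≤j) ⟩
    j - i          ≤⟨ ℤP.+-monoˡ-≤ (ℤ.- i) j≤i+k ⟩
    i + + k - i    ≡⟨ cancel i (+ k) ⟩
    + k            ∎)
  where
  open ℤP.≤-Reasoning
  cancel : ∀ p q → p + q - p ≡ q
  cancel = solve-∀

-- Clamping is 1-Lipschitz: for y ≤ z, writing z = y + k with k = |z - y|,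
-- the clamped values lie between clamp y and clamp y + k.
clamp-contracts : ∀ {y z} c → y ℤ.≤ z → ∣ clamp z c - clamp y c ∣ ≤ ∣ z - y ∣
clamp-contracts {y} {z} c y≤z = dist-le k (clamp-mono c y≤z)
  (subst (λ w → clamp w c ℤ.≤ clamp y c + + k) z≡y+k (clamp-shift y k c))
  where
  k : ℕ
  k = ∣ z - y ∣
  z≡y+k : y + + k ≡ z
  z≡y+k = begin
    y + + k        ≡⟨ cong (λ w → y + w) (ℤP.0≤i⇒+∣i∣≡i (ℤP.i≤j⇒0≤j-i y≤z)) ⟩
    y + (z - y)    ≡⟨ add-sub y z ⟩
    z              ∎
    where
    open ≡-Reasoning
    add-sub : ∀ p q → p + (q - p) ≡ q
    add-sub = solve-∀

inf-attained : ∀ {d} (C : Fin d → ℕ) (a : Pt d → Pt d) {m M : Pt d} {i : Fin d} {z : ℤ} →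
  InBox C m M m → (∀ x → InBox C m M x → a m i ℤ.≤ a x i) →
  IsInfAt C a m M i z → z ≡ a m i
inf-attained C a m∈ m-least (lower , greatest) =
  ℤP.≤-antisym (lower _ m∈) (greatest _ m-least)

sup-attained : ∀ {d} (C : Fin d → ℕ) (a : Pt d → Pt d) {m M : Pt d} {i : Fin d} {z : ℤ} →
  InBox C m M M → (∀ x → InBox C m M x → a x i ℤ.≤ a M i) →
  IsSupAt C a m M i z → z ≡ a M i
sup-attained C a M∈ M-greatest (upper , least) =
  ℤP.≤-antisym (least _ M-greatest) (upper _ M∈)

unblocked-action : ∀ {d} {C : Fin d → ℕ} {a : Pt d → Pt d} {v : Pt d} {R : Fin d → Fin d → Set} →
  IsASHE C a v R → EmptyRel R →
  ∀ x → InS C x → ∀ i → a x i ≡ clamp (x i + v i) (C i)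
unblocked-action ashe empty x x∈S i =
  proj₂ (ashe x x∈S i) (λ { (j , _ , Rji) → empty j i Rji })

image-endpoints : ∀ {d} (C : Fin d → ℕ) (a : Pt d → Pt d) (v : Pt d) (R : Fin d → Fin d → Set) →
  IsASHE C a v R → EmptyRel R →
  (m M : Pt d) → InS C m → InS C M → m ≤ᵥ M →
  (m' M' : Pt d) → IsBoxImage C a m M m' M' → ∀ i →
  (m' i ≡ clamp (m i + v i) (C i)) × (M' i ≡ clamp (M i + v i) (C i))
image-endpoints C a v R ashe empty m M m∈S M∈S m≤M m' M' image i =
  trans (inf-attained C a m∈ m-least (proj₁ (image i))) (act m m∈S) ,
  trans (sup-attained C a M∈ M-greatest (proj₂ (image i))) (act M M∈S)
  where
  act : ∀ x → InS C x → a x i ≡ clamp (x i + v i) (C i)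
  act x x∈S = unblocked-action ashe empty x x∈S i
  m∈ : InBox C m M m
  m∈ = m∈S , (λ _ → ℤP.≤-refl) , m≤M
  M∈ : InBox C m M M
  M∈ = M∈S , m≤M , (λ _ → ℤP.≤-refl)
  shifted : ∀ {p q} → p ℤ.≤ q → clamp (p + v i) (C i) ℤ.≤ clamp (q + v i) (C i)
  shifted p≤q = clamp-mono (C i) (ℤP.+-monoˡ-≤ (v i) p≤q)
  m-least : ∀ x → InBox C m M x → a m i ℤ.≤ a x i
  m-least x (x∈S , m≤x , _) =
    subst₂ ℤ._≤_ (sym (act m m∈S)) (sym (act x x∈S)) (shifted (m≤x i))
  M-greatest : ∀ x → InBox C m M x → a x i ℤ.≤ a M i
  M-greatest x (x∈S , _ , x≤M) =
    subst₂ ℤ._≤_ (sym (act x x∈S)) (sym (act M M∈S)) (shifted (x≤M i))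

sumFin-mono : ∀ {d} {f g : Fin d → ℕ} → (∀ i → f i ≤ g i) → sumFin f ≤ sumFin g
sumFin-mono {ℕ.zero} f≤g = ℕ.z≤n
sumFin-mono {ℕ.suc d} f≤g = ℕP.+-mono-≤ (f≤g zero) (sumFin-mono (λ i → f≤g (suc i)))

corollary1 : (d : ℕ) (C : Fin d → ℕ) (a : Pt d → Pt d) (v : Pt d) (R : Fin d → Fin d → Set) →
    IsASHE C a v R → EmptyRel R →
    (m M : Pt d) → InS C m → InS C M → m ≤ᵥ M →
    (m' M' : Pt d) → IsBoxImage C a m M m' M' →
    norm1 (M' -ᵥ m') ≤ norm1 (M -ᵥ m)
corollary1 d C a v R ashe empty m M m∈S M∈S m≤M m' M' image = sumFin-mono side
  where
  side : ∀ i → ∣ M' i - m' i ∣ ≤ ∣ M i - m i ∣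
  side i = begin
    ∣ M' i - m' i ∣                                       ≡⟨ cong₂ (λ p q → ∣ p - q ∣) M'≡ m'≡ ⟩
    ∣ clamp (M i + v i) (C i) - clamp (m i + v i) (C i) ∣ ≤⟨ clamp-contracts (C i) (ℤP.+-monoˡ-≤ (v i) (m≤M i)) ⟩
    ∣ (M i + v i) - (m i + v i) ∣                         ≡⟨ cong ∣_∣ (translate (M i) (m i) (v i)) ⟩
    ∣ M i - m i ∣                                         ∎
    where
    open ℕP.≤-Reasoning
    m'≡ : m' i ≡ clamp (m i + v i) (C i)
    m'≡ = proj₁ (image-endpoints C a v R ashe empty m M m∈S M∈S m≤M m' M' image i)
    M'≡ : M' i ≡ clamp (M i + v i) (C i)
    M'≡ = proj₂ (image-endpoints C a v R ashe empty m M m∈S M∈S m≤M m' M' image i)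
    translate : ∀ p q w → (p + w) - (q + w) ≡ p - q
    translate = solve-∀
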